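{- Let $r\geq 2$ be an integer. Every $G\in\mathcal{M}_r(\mathcal{C})$ satisfies $r+1\leq\delta(G)\leq 2r-1$ and is $2$-connected.
   Context: All graphs are finite and simple; $\delta(G)$ is the minimum degree. $\mathcal{R}_r(\mathcal{C})$ is the class of graphs $G$ such that every colouring of the edges of $G$ with $r$ colours admits a monochromatic cycle (of any length). $\mathcal{M}_r(\mathcal{C})$ is the class of graphs in $\mathcal{R}_r(\mathcal{C})$ no proper subgraph of which is in $\mathcal{R}_r(\mathcal{C})$. -}

module Defs where

open import Data.Nat using (ℕ; zero; suc; _+_; _≤_; _⊓_)
open import Data.Fin using (Fin; zero; suc; inject₁; fromℕ)
open import Data.Bool using (Bool; true; false; if_then_else_)
open import Data.List using (List; map; foldr)
open import Data.Nat.ListAction using (sum)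
open import Data.List using (allFin)
open import Data.Product using (Σ; ∃; _×_; _,_)
open import Data.Sum using (_⊎_)
open import Relation.Binary.PropositionalEquality using (_≡_; _≢_)
open import Relation.Nullary using (¬_)
open import Function.Definitions using (Injective)

record Graph (n : ℕ) : Set where
  field
    adj     : Fin n → Fin n → Bool
    sym     : ∀ u v → adj u v ≡ adj v u
    irrefl  : ∀ v → adj v v ≡ false
open Graph public

-- An r-colouring of the edges: a symmetric colour assignment to pairs
-- (only its values on edges matter).
record EdgeColouring {n : ℕ} (G : Graph n) (r : ℕ) : Set where
  field
    col    : Fin n → Fin n → Fin r
    colSym : ∀ u v → col u v ≡ col v u
open EdgeColouring public

record MonoCycle {n r : ℕ} (G : Graph n) (c : EdgeColouring G r) : Set where
  field
    m       : ℕ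
    verts   : Fin (suc (suc (suc m))) → Fin n
    distinct : Injective _≡_ _≡_ verts
    colour  : Fin r
    stepAdj : ∀ (i : Fin (suc (suc m))) →
              adj G (verts (inject₁ i)) (verts (suc i)) ≡ true
    stepCol : ∀ (i : Fin (suc (suc m))) →
              col c (verts (inject₁ i)) (verts (suc i)) ≡ colour
    closeAdj : adj G (verts (fromℕ (suc (suc m)))) (verts zero) ≡ true
    closeCol : col c (verts (fromℕ (suc (suc m)))) (verts zero) ≡ colour

InR : (r : ℕ) → {n : ℕ} → Graph n → Set
InR r G = (c : EdgeColouring G r) → MonoCycle G c

record SubgraphVia {m n : ℕ} (H : Graph m) (G : Graph n) (f : Fin m → Fin n) : Set where
  field
    inj      : Injective _≡_ _≡_ f
    edgesIn  : ∀ u v → adj H u v ≡ true → adj G (f u) (f v) ≡ true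
open SubgraphVia public

ProperVia : {m n : ℕ} (H : Graph m) (G : Graph n) (f : Fin m → Fin n) → Set
ProperVia H G f =
  (∃ λ x → ∀ u → f u ≢ x)
  ⊎ (∃ λ x → ∃ λ y → adj G x y ≡ true ×
       (∀ u v → f u ≡ x → f v ≡ y → adj H u v ≡ false))

InM : (r : ℕ) → {n : ℕ} → Graph n → Set
InM r {n} G = InR r G ×
  (∀ (m : ℕ) (H : Graph m) (f : Fin m → Fin n) →
     SubgraphVia H G f → ProperVia H G f → ¬ InR r H)

degree : {n : ℕ} → Graph n → Fin n → ℕ
degree {n} G v = sum (map (λ u → if adj G v u then 1 else 0) (allFin n))

-- Minimum degree δ(G) (conventionally 0 for the empty graph).
minDegree : {n : ℕ} → Graph n → ℕ
minDegree {zero}  G = 0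
minDegree {suc k} G = foldr _⊓_ (degree G zero) (map (degree G) (allFin (suc k)))

data ReachAvoid {n : ℕ} (G : Graph n) (x : Fin n) : Fin n → Fin n → Set where
  here : ∀ {u} → ReachAvoid G x u u
  step : ∀ {u w v} → adj G u w ≡ true → w ≢ x → ReachAvoid G x w v → ReachAvoid G x u v

data Reach {n : ℕ} (G : Graph n) : Fin n → Fin n → Set where
  here : ∀ {u} → Reach G u u
  step : ∀ {u w v} → adj G u w ≡ true → Reach G w v → Reach G u v

Connected : {n : ℕ} → Graph n → Set
Connected G = ∀ u v → Reach G u v

TwoConnected : {n : ℕ} → Graph n → Set
TwoConnected {n} G = (3 ≤ n) × Connected G ×
  (∀ x u v → u ≢ x → v ≢ x → ReachAvoid G x u v)

module Submission where

-- If some vertex v has degree at most r, colour the edges at v with pairwise distinct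
-- colours and the rest like a colouring of G − v without monochromatic cycles: a
-- monochromatic cycle would have to pass through v and use two edges of one colour there,
-- so G − v would already be in R_r. If instead δ(G) ≥ 2r, then G minus any edge still has
-- more than r(n − 1) edges, hence is not a union of r forests, and again lies in R_r.
-- Finally, if x separated u from v, G would split at x into two proper subgraphs A ∋ u and
-- B ∋ v meeting only in x; as every cycle of G lies in A or in B, colourings of A and B
-- without monochromatic cycles would combine into one of G.

open import Defs hiding (sym)
open import Data.Nat using (ℕ; NonZero; >-nonZero⁻¹; zero; suc; _+_; _*_; _∸_; _≤_; _<_; _⊓_; z≤n; s≤s; z<s; _≤?_; _<?_)
open import Data.Nat.Properties
open import Data.Nat.DivMod
open import Data.Nat.ListAction using () renaming (sum to listSum)
open import Data.Fin as Fin using (Fin; zero; suc; toℕ; fromℕ; fromℕ<; inject₁; punchIn; punchOut)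
open import Data.Fin.Properties using (any?; all?; toℕ-injective; toℕ-fromℕ<; toℕ-fromℕ; toℕ-inject₁; toℕ-lower₁; toℕ<n; injective⇒≤;
  punchIn-injective; punchInᵢ≢i; punchIn-punchOut; punchOut-punchIn; punchOut-cong)
open import Data.Bool using (Bool; true; false; if_then_else_; _∧_; _∨_; not)
open import Data.Bool.Properties using (∧-comm; ∧-zeroʳ; ∧-identityʳ; ∧-conicalˡ; ∧-conicalʳ)
open import Data.List using (map; foldr; tabulate)
open import Data.Product using (∃; ∃₂; _×_; _,_; proj₁; proj₂; swap)
open import Data.Sum using (_⊎_; inj₁; inj₂; [_,_])
open import Data.Vec.Functional using (_∷_)
open import Data.Empty using (⊥; ⊥-elim)
open import Relation.Binary.Definitions using (tri<; tri≈; tri>)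
open import Relation.Nullary using (¬_; Dec; yes; no; does; _×-dec_; _⊎-dec_; _→-dec_)
open import Relation.Nullary.Decidable using (dec-true; dec-false; map′; does-⇔; decidable-stable; ¬?)
open import Function.Bundles using (mk⇔)
open import Relation.Binary.PropositionalEquality
  using (_≡_; _≢_; refl; sym; trans; cong; cong₂; subst; subst₂; module ≡-Reasoning)
open import Function using (_∘_; id)
open import Induction.WellFounded using (Acc; acc)
open import Data.Nat.Induction using (<-wellFounded)
open import Algebra.Properties.CommutativeMonoid.Sum +-0-commutativeMonoid
  using (sum; sum-syntax; ∑-distrib-+; ∑-comm; sum-cong-≗)

-- Finite sums

𝟙 : Bool → ℕ
𝟙 b = if b then 1 else 0

𝟙≤1 : ∀ b → 𝟙 b ≤ 1
𝟙≤1 true  = ≤-refl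
𝟙≤1 false = z≤n

𝟙-mono : ∀ {a b} → (a ≡ true → b ≡ true) → 𝟙 a ≤ 𝟙 b
𝟙-mono {false} _ = z≤n
𝟙-mono {true} a⇒b rewrite a⇒b refl = ≤-refl

𝟙-pos : ∀ {b} → 1 ≤ 𝟙 b → b ≡ true
𝟙-pos {true} _ = refl

from-does : ∀ {A : Set} (a? : Dec A) → does a? ≡ true → A
from-does (yes a) _ = a

𝟙-does-mono : ∀ {A B : Set} (a? : Dec A) (b? : Dec B) → (A → B) → 𝟙 (does a?) ≤ 𝟙 (does b?)
𝟙-does-mono a? b? A⇒B = 𝟙-mono (dec-true b? ∘ A⇒B ∘ from-does a?)

𝟙-does-< : ∀ {A B : Set} (a? : Dec A) (b? : Dec B) → ¬ A → B → 𝟙 (does a?) < 𝟙 (does b?)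
𝟙-does-< a? b? ¬a b rewrite dec-false a? ¬a | dec-true b? b = ≤-refl

∑-mono-≤ : ∀ {n} {f g : Fin n → ℕ} → (∀ i → f i ≤ g i) → sum f ≤ sum g
∑-mono-≤ {zero}  f≤g = z≤n
∑-mono-≤ {suc n} f≤g = +-mono-≤ (f≤g zero) (∑-mono-≤ (f≤g ∘ suc))

∑-mono-< : ∀ {n} {f g : Fin n → ℕ} → (∀ i → f i ≤ g i) → ∀ j → f j < g j → sum f < sum g
∑-mono-< f≤g zero    fj<gj = +-mono-<-≤ fj<gj (∑-mono-≤ (f≤g ∘ suc))
∑-mono-< f≤g (suc j) fj<gj = +-mono-≤-< (f≤g zero) (∑-mono-< (f≤g ∘ suc) j fj<gj)

∑-const : ∀ n c → ∑[ i < n ] c ≡ n * c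
∑-const zero    c = refl
∑-const (suc n) c = cong (c +_) (∑-const n c)

∑-≤-* : ∀ {n} (f : Fin n → ℕ) {c} → (∀ i → f i ≤ c) → sum f ≤ n * c
∑-≤-* {n} f {c} f≤c = subst (sum f ≤_) (∑-const n c) (∑-mono-≤ f≤c)

*-≤-∑ : ∀ {n} (f : Fin n → ℕ) {c} → (∀ i → c ≤ f i) → n * c ≤ sum f
*-≤-∑ {n} f {c} c≤f = subst (_≤ sum f) (∑-const n c) (∑-mono-≤ c≤f)

∑-𝟙≤ : ∀ {n} (b : Fin n → Bool) → ∑[ i < n ] 𝟙 (b i) ≤ n
∑-𝟙≤ {n} b = subst (∑[ i < n ] 𝟙 (b i) ≤_) (*-identityʳ n) (∑-≤-* (𝟙 ∘ b) (𝟙≤1 ∘ b))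

≤-∑ : ∀ {n} (f : Fin n → ℕ) j → f j ≤ sum f
≤-∑ f zero    = m≤m+n (f zero) _
≤-∑ f (suc j) = ≤-trans (≤-∑ (f ∘ suc) j) (m≤n+m _ (f zero))

∑-𝟙-≟ : ∀ {n} (j : Fin n) → ∑[ i < n ] 𝟙 (does (i Fin.≟ j)) ≡ 1
∑-𝟙-≟ {suc n} zero    = cong suc (trans (∑-const n 0) (*-zeroʳ n))
∑-𝟙-≟ {suc n} (suc j) = ∑-𝟙-≟ j

∑-pos : ∀ {n} (f : Fin n → ℕ) → 1 ≤ sum f → ∃ λ i → 1 ≤ f i
∑-pos {suc n} f 1≤∑ with f zero in eq
... | suc _ = zero , subst (1 ≤_) (sym eq) (s≤s z≤n)
... | zero  = let i , 1≤fi = ∑-pos (f ∘ suc) 1≤∑ in suc i , 1≤fi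

listSum-tabulate : ∀ {m n} (f : Fin n → ℕ) (g : Fin m → Fin n) →
                   listSum (map f (tabulate g)) ≡ ∑[ i < m ] f (g i)
listSum-tabulate {zero}  f g = refl
listSum-tabulate {suc m} f g = cong (f (g zero) +_) (listSum-tabulate f (g ∘ suc))

𝟙-∧-not-∨ : ∀ g p q → 𝟙 g ≤ 𝟙 (g ∧ not (p ∨ q)) + 𝟙 p + 𝟙 q
𝟙-∧-not-∨ false p     q     = z≤n
𝟙-∧-not-∨ true  true  q     = s≤s z≤n
𝟙-∧-not-∨ true  false true  = ≤-refl
𝟙-∧-not-∨ true  false false = ≤-refl

∑-𝟙-∧-≟ : ∀ {n} b (y : Fin n) → ∑[ z < n ] 𝟙 (b ∧ does (z Fin.≟ y)) ≡ 𝟙 b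
∑-𝟙-∧-≟ {n} true  y = ∑-𝟙-≟ y
∑-𝟙-∧-≟ {n} false y = trans (∑-const n 0) (*-zeroʳ n)

∑-two : ∀ {n} (f : Fin n → ℕ) {i j} → i ≢ j → 1 ≤ f i → 1 ≤ f j → 2 ≤ sum f
∑-two f {zero}  {zero}  i≢j _  _  = ⊥-elim (i≢j refl)
∑-two f {zero}  {suc j} _   fi fj = +-mono-≤ fi (≤-trans fj (≤-∑ (f ∘ suc) j))
∑-two f {suc i} {zero}  _   fi fj = +-mono-≤ fj (≤-trans fi (≤-∑ (f ∘ suc) i))
∑-two f {suc i} {suc j} i≢j fi fj = ≤-trans (∑-two (f ∘ suc) (i≢j ∘ cong suc) fi fj) (m≤n+m _ (f zero))

-- Degrees

degree≡∑ : ∀ {n} (G : Graph n) v → degree G v ≡ ∑[ u < n ] 𝟙 (adj G v u)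
degree≡∑ G v = listSum-tabulate (λ u → 𝟙 (adj G v u)) id

foldr-⊓-≤ : ∀ {m n} (h : Fin n → ℕ) (g : Fin m → Fin n) z i → foldr _⊓_ z (map h (tabulate g)) ≤ h (g i)
foldr-⊓-≤ h g z zero    = m⊓n≤m _ _
foldr-⊓-≤ h g z (suc i) = ≤-trans (m⊓n≤n _ _) (foldr-⊓-≤ h (g ∘ suc) z i)

≤-foldr-⊓ : ∀ {m n} (h : Fin n → ℕ) (g : Fin m → Fin n) {z c} → c ≤ z → (∀ i → c ≤ h (g i)) →
            c ≤ foldr _⊓_ z (map h (tabulate g))
≤-foldr-⊓ {zero}  h g c≤z c≤h = c≤z
≤-foldr-⊓ {suc m} h g c≤z c≤h = ⊓-glb (c≤h zero) (≤-foldr-⊓ h (g ∘ suc) c≤z (c≤h ∘ suc))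

minDegree≤degree : ∀ {n} (G : Graph n) v → minDegree G ≤ degree G v
minDegree≤degree {suc n} G v = foldr-⊓-≤ (degree G) id _ v

≤-minDegree : ∀ {n c} (G : Graph (suc n)) → (∀ v → c ≤ degree G v) → c ≤ minDegree G
≤-minDegree G c≤deg = ≤-foldr-⊓ (degree G) id (c≤deg zero) c≤deg

neighbour : ∀ {n} (G : Graph n) v → 1 ≤ degree G v → ∃ λ u → adj G v u ≡ true
neighbour G v 1≤deg =
  let u , 1≤𝟙 = ∑-pos _ (subst (1 ≤_) (degree≡∑ G v) 1≤deg) in u , 𝟙-pos 1≤𝟙

adj⇒≢ : ∀ {n} (G : Graph n) {a b} → adj G a b ≡ true → a ≢ b
adj⇒≢ G {a} ab refl with trans (sym ab) (irrefl G a)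
... | ()

adj⇒1≤degree : ∀ {n} (G : Graph n) {v u} → adj G v u ≡ true → 1 ≤ degree G v
adj⇒1≤degree G {v} {u} vu = subst (1 ≤_) (sym (degree≡∑ G v))
  (≤-trans (≤-reflexive (cong 𝟙 (sym vu))) (≤-∑ (λ w → 𝟙 (adj G v w)) u))

module _ {n} {G H : Graph n} (H⊆G : ∀ a b → adj H a b ≡ true → adj G a b ≡ true) where

  degree-⊆ : ∀ v → degree H v ≤ degree G v
  degree-⊆ v = subst₂ _≤_ (sym (degree≡∑ H v)) (sym (degree≡∑ G v)) (∑-mono-≤ λ u → 𝟙-mono (H⊆G v u))

  degree-⊂ : ∀ {v u} → adj G v u ≡ true → adj H v u ≡ false → degree H v < degree G v
  degree-⊂ {v} {u} vu ¬vu = subst₂ _<_ (sym (degree≡∑ H v)) (sym (degree≡∑ G v))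
    (∑-mono-< (λ w → 𝟙-mono (H⊆G v w)) u (subst₂ (λ h g → 𝟙 h < 𝟙 g) (sym ¬vu) (sym vu) ≤-refl))

degreeSum : ∀ {n} → Graph n → ℕ
degreeSum {n} K = ∑[ u < n ] degree K u

nonIsolated : ∀ {n} → Graph n → ℕ
nonIsolated {n} K = ∑[ u < n ] 𝟙 (does (1 ≤? degree K u))

nonIsolated≤n : ∀ {n} (K : Graph n) → nonIsolated K ≤ n
nonIsolated≤n K = ∑-𝟙≤ (λ u → does (1 ≤? degree K u))

nonIsolated-at : ∀ {n} (K : Graph n) {u z} → adj K u z ≡ true → 1 ≤ 𝟙 (does (1 ≤? degree K u))
nonIsolated-at K uz = ≤-reflexive (sym (cong 𝟙 (dec-true (1 ≤? _) (adj⇒1≤degree K uz))))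

-- Subgraphs

deleteVertex : ∀ {n} → Graph (suc n) → Fin (suc n) → Graph n
deleteVertex G v = record
  { adj    = λ a b → adj G (punchIn v a) (punchIn v b)
  ; sym    = λ a b → Graph.sym G (punchIn v a) (punchIn v b)
  ; irrefl = λ a → irrefl G (punchIn v a)
  }

induced : ∀ {n} (G : Graph n) {P : Fin n → Set} → (∀ w → Dec (P w)) → Graph n
induced G P? = record
  { adj    = λ a b → adj G a b ∧ (does (P? a) ∧ does (P? b))
  ; sym    = λ a b → cong₂ _∧_ (Graph.sym G a b) (∧-comm (does (P? a)) (does (P? b)))
  ; irrefl = λ a → cong (_∧ _) (irrefl G a)
  }

module _ {n} {G : Graph n} {P : Fin n → Set} (P? : ∀ w → Dec (P w)) where

  induced-adj : ∀ {a b} → P a → P b → adj G a b ≡ true → adj (induced G P?) a b ≡ true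
  induced-adj {a} {b} pa pb ab =
    trans (cong₂ (λ p q → adj G a b ∧ (p ∧ q)) (dec-true (P? a) pa) (dec-true (P? b) pb))
          (trans (∧-identityʳ (adj G a b)) ab)

Joins : ∀ {n} → Fin n → Fin n → Fin n → Fin n → Set
Joins w y a b = (a ≡ w × b ≡ y) ⊎ (a ≡ y × b ≡ w)

joins? : ∀ {n} (w y a b : Fin n) → Dec (Joins w y a b)
joins? w y a b = (a Fin.≟ w ×-dec b Fin.≟ y) ⊎-dec (a Fin.≟ y ×-dec b Fin.≟ w)

Joins-sym : ∀ {n} {w y a b : Fin n} → Joins w y a b → Joins w y b a
Joins-sym = [ inj₂ ∘ swap , inj₁ ∘ swap ]

deleteEdge : ∀ {n} → Graph n → Fin n → Fin n → Graph n
deleteEdge G w y = record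
  { adj    = λ a b → adj G a b ∧ not (does (joins? w y a b))
  ; sym    = λ a b → cong₂ (λ e j → e ∧ not j) (Graph.sym G a b)
                       (does-⇔ (mk⇔ Joins-sym Joins-sym) (joins? w y a b) (joins? w y b a))
  ; irrefl = λ a → cong (_∧ _) (irrefl G a)
  }

module _ {n} (G : Graph n) (w y : Fin n) where

  deleteEdge⊆ : ∀ a b → adj (deleteEdge G w y) a b ≡ true → adj G a b ≡ true
  deleteEdge⊆ a b = ∧-conicalˡ _ _

  deleteEdge-deleted : adj (deleteEdge G w y) w y ≡ false
  deleteEdge-deleted = trans (cong (λ j → adj G w y ∧ not j) (dec-true (joins? w y w y) (inj₁ (refl , refl))))
                             (∧-zeroʳ (adj G w y))

  degree-deleteEdge : ∀ a → degree G a ≤ degree (deleteEdge G w y) a + 𝟙 (does (a Fin.≟ w)) + 𝟙 (does (a Fin.≟ y))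
  degree-deleteEdge a = begin
    degree G a                                              ≡⟨ degree≡∑ G a ⟩
    ∑[ b < n ] 𝟙 (adj G a b)                                ≤⟨ ∑-mono-≤ (λ b → 𝟙-∧-not-∨ (adj G a b) _ _) ⟩
    ∑[ b < n ] (𝟙 (adj G′ a b) + 𝟙 (atW b) + 𝟙 (atY b))     ≡⟨ ∑-distrib-+ (λ b → 𝟙 (adj G′ a b) + 𝟙 (atW b)) (𝟙 ∘ atY) ⟩
    ∑[ b < n ] (𝟙 (adj G′ a b) + 𝟙 (atW b)) + ∑[ b < n ] 𝟙 (atY b)
        ≡⟨ cong (_+ ∑[ b < n ] 𝟙 (atY b)) (∑-distrib-+ (𝟙 ∘ adj G′ a) (𝟙 ∘ atW)) ⟩
    ∑[ b < n ] 𝟙 (adj G′ a b) + ∑[ b < n ] 𝟙 (atW b) + ∑[ b < n ] 𝟙 (atY b)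
        ≡⟨ cong₂ (λ s t → s + t + ∑[ b < n ] 𝟙 (atY b)) (degree≡∑ G′ a) (sym (∑-𝟙-∧-≟ _ y)) ⟨
    degree G′ a + 𝟙 (does (a Fin.≟ w)) + ∑[ b < n ] 𝟙 (atY b)  ≡⟨ cong (degree G′ a + 𝟙 (does (a Fin.≟ w)) +_) (∑-𝟙-∧-≟ _ w) ⟩
    degree G′ a + 𝟙 (does (a Fin.≟ w)) + 𝟙 (does (a Fin.≟ y))  ∎
    where
    open ≤-Reasoning
    G′ : Graph n
    G′ = deleteEdge G w y
    atW atY : Fin n → Bool
    atW b = does (a Fin.≟ w) ∧ does (b Fin.≟ y)
    atY b = does (a Fin.≟ y) ∧ does (b Fin.≟ w)

degreeSum-deleteEdge : ∀ {n} (G : Graph n) w y → degreeSum G ≤ degreeSum (deleteEdge G w y) + 2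
degreeSum-deleteEdge {n} G w y = begin
  degreeSum G                                                         ≤⟨ ∑-mono-≤ (degree-deleteEdge G w y) ⟩
  ∑[ a < n ] (degree G′ a + 𝟙 (does (a Fin.≟ w)) + 𝟙 (does (a Fin.≟ y)))
      ≡⟨ ∑-distrib-+ (λ a → degree G′ a + 𝟙 (does (a Fin.≟ w))) (λ a → 𝟙 (does (a Fin.≟ y))) ⟩
  ∑[ a < n ] (degree G′ a + 𝟙 (does (a Fin.≟ w))) + ∑[ a < n ] 𝟙 (does (a Fin.≟ y))
      ≡⟨ cong₂ _+_ (∑-distrib-+ (degree G′) (λ a → 𝟙 (does (a Fin.≟ w)))) (∑-𝟙-≟ y) ⟩
  degreeSum G′ + ∑[ a < n ] 𝟙 (does (a Fin.≟ w)) + 1                  ≡⟨ cong (λ s → degreeSum G′ + s + 1) (∑-𝟙-≟ w) ⟩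
  degreeSum G′ + 1 + 1                                                ≡⟨ +-assoc (degreeSum G′) 1 1 ⟩
  degreeSum G′ + 2                                                    ∎
  where
  open ≤-Reasoning
  G′ : Graph n
  G′ = deleteEdge G w y

colourClass : ∀ {n r} (H : Graph n) → EdgeColouring H r → Fin r → Graph n
colourClass H c κ = record
  { adj    = λ a b → adj H a b ∧ does (κ Fin.≟ col c a b)
  ; sym    = λ a b → cong₂ (λ e k → e ∧ does (κ Fin.≟ k)) (Graph.sym H a b) (colSym c a b)
  ; irrefl = λ a → cong (_∧ _) (irrefl H a)
  }

module _ {r n} {G : Graph n} (minimal : InM r G) where

  minimal⇒¬InR-spanning : (H : Graph n) → (∀ a b → adj H a b ≡ true → adj G a b ≡ true) →
                          ∀ {a b} → adj G a b ≡ true → adj H a b ≡ false → ¬ InR r H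
  minimal⇒¬InR-spanning H H⊆G {a} {b} ab ¬ab = proj₂ minimal n H id
    (record { inj = id ; edgesIn = H⊆G }) (inj₂ (a , b , ab , λ { _ _ refl refl → ¬ab }))

  minimal⇒¬InR-induced : ∀ {P : Fin n → Set} (P? : ∀ w → Dec (P w)) →
                         ∀ {w z} → ¬ P w → adj G w z ≡ true → ¬ InR r (induced G P?)
  minimal⇒¬InR-induced P? {w} {z} ¬Pw wz = minimal⇒¬InR-spanning (induced G P?)
    (λ a b → ∧-conicalˡ _ _) wz
    (trans (cong (λ p → adj G w z ∧ (p ∧ does (P? z))) (dec-false (P? w) ¬Pw)) (∧-zeroʳ (adj G w z)))

minimal⇒¬InR-deleteVertex : ∀ {r n} {G : Graph (suc n)} → InM r G → ∀ v → ¬ InR r (deleteVertex G v)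
minimal⇒¬InR-deleteVertex {G = G} minimal v = proj₂ minimal _ (deleteVertex G v) (punchIn v)
  (record { inj = punchIn-injective v _ _ ; edgesIn = λ _ _ e → e }) (inj₁ (v , punchInᵢ≢i v))

-- Walks avoiding a vertex

module _ {n} {G : Graph n} {x : Fin n} where

  ReachAvoid-snoc : ∀ {u w v} → ReachAvoid G x u w → adj G w v ≡ true → v ≢ x → ReachAvoid G x u v
  ReachAvoid-snoc here           wv v≢x = step wv v≢x here
  ReachAvoid-snoc (step a w≢x p) wv v≢x = step a w≢x (ReachAvoid-snoc p wv v≢x)

  ReachAvoid-++ : ∀ {u w v} → ReachAvoid G x u w → ReachAvoid G x w v → ReachAvoid G x u v
  ReachAvoid-++ here           q = q
  ReachAvoid-++ (step a w≢x p) q = step a w≢x (ReachAvoid-++ p q)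

  ReachAvoid-reverse : ∀ {u v} → u ≢ x → ReachAvoid G x u v → ReachAvoid G x v u
  ReachAvoid-reverse u≢x here           = here
  ReachAvoid-reverse u≢x (step a w≢x p) =
    ReachAvoid-snoc (ReachAvoid-reverse w≢x p) (trans (Graph.sym G _ _) a) u≢x

  ReachAvoid⇒Reach : ∀ {u v} → ReachAvoid G x u v → Reach G u v
  ReachAvoid⇒Reach here         = here
  ReachAvoid⇒Reach (step a _ p) = step a (ReachAvoid⇒Reach p)

  ¬ReachAvoid-avoided : ∀ {u} → u ≢ x → ¬ ReachAvoid G x u x
  ¬ReachAvoid-avoided u≢x here           = u≢x refl
  ¬ReachAvoid-avoided u≢x (step _ w≢x p) = ¬ReachAvoid-avoided w≢x p

module Reachability {n} (G : Graph n) (x u : Fin n) where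

  Reached : ℕ → Fin n → Set
  Reached zero    w = w ≡ u
  Reached (suc k) w = Reached k w ⊎ (w ≢ x × ∃ λ y → Reached k y × adj G y w ≡ true)

  reached? : ∀ k w → Dec (Reached k w)
  reached? zero    w = w Fin.≟ u
  reached? (suc k) w = reached? k w ⊎-dec
    (¬? (w Fin.≟ x) ×-dec any? (λ y → reached? k y ×-dec (adj G y w Data.Bool.≟ true)))

  Reached⇒ReachAvoid : ∀ k {w} → Reached k w → ReachAvoid G x u w
  Reached⇒ReachAvoid zero    refl                       = here
  Reached⇒ReachAvoid (suc k) (inj₁ old)                 = Reached⇒ReachAvoid k old
  Reached⇒ReachAvoid (suc k) (inj₂ (w≢x , y , ry , yw)) = ReachAvoid-snoc (Reached⇒ReachAvoid k ry) yw w≢x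

  Reached-start : ∀ k → Reached k u
  Reached-start zero    = refl
  Reached-start (suc k) = inj₁ (Reached-start k)

  size : ℕ → ℕ
  size k = ∑[ w < n ] 𝟙 (does (reached? k w))

  Saturated : ℕ → Set
  Saturated k = ∀ w → Reached (suc k) w → Reached k w

  saturated-or-grows : ∀ k → Saturated k ⊎ size k < size (suc k)
  saturated-or-grows k with any? (λ w → reached? (suc k) w ×-dec ¬? (reached? k w))
  ... | yes (w , new , ¬old) = inj₂ (∑-mono-< (λ v → 𝟙-does-mono (reached? k v) (reached? (suc k) v) inj₁) w
                                              (𝟙-does-< (reached? k w) (reached? (suc k) w) ¬old new))
  ... | no none = inj₁ λ w new → decidable-stable (reached? k w) λ ¬old → none (w , new , ¬old)

  saturated-or-large : ∀ k → ∃ Saturated ⊎ k < size k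
  saturated-or-large zero = inj₂ (≤-reflexive (sym (∑-𝟙-≟ u)))
  saturated-or-large (suc k) with saturated-or-large k
  ... | inj₁ sat = inj₁ sat
  ... | inj₂ k<size with saturated-or-grows k
  ...   | inj₁ sat   = inj₁ (k , sat)
  ...   | inj₂ grows = inj₂ (≤-<-trans k<size grows)

  saturation : ∃ Saturated
  saturation with saturated-or-large n
  ... | inj₁ sat    = sat
  ... | inj₂ n<size = ⊥-elim (≤⇒≯ (∑-𝟙≤ (does ∘ reached? n)) n<size)

  depth : ℕ
  depth = proj₁ saturation

  ReachAvoid⇒Reached : ∀ {a w} → Reached depth a → ReachAvoid G x a w → Reached depth w
  ReachAvoid⇒Reached ra here             = ra
  ReachAvoid⇒Reached ra (step aw w≢x p) = ReachAvoid⇒Reached (proj₂ saturation _ (inj₂ (w≢x , _ , ra , aw))) p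

reachAvoid? : ∀ {n} (G : Graph n) x u w → Dec (ReachAvoid G x u w)
reachAvoid? G x u w = map′ (Reached⇒ReachAvoid depth) (ReachAvoid⇒Reached (Reached-start depth)) (reached? depth w)
  where open Reachability G x u

-- Monochromatic cycles

ColouredEdge : ∀ {n r} (G : Graph n) → EdgeColouring G r → Fin r → Fin n → Fin n → Set
ColouredEdge G c κ a b = adj G a b ≡ true × col c a b ≡ κ

ColouredEdge-sym : ∀ {n r} {G : Graph n} {c : EdgeColouring G r} {κ a b} →
                   ColouredEdge G c κ a b → ColouredEdge G c κ b a
ColouredEdge-sym {G = G} {c} {a = a} {b} (ab , cab) = trans (Graph.sym G b a) ab , trans (colSym c b a) cab

colouredEdge? : ∀ {n r} (G : Graph n) (c : EdgeColouring G r) κ a b → Dec (ColouredEdge G c κ a b)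
colouredEdge? G c κ a b = (adj G a b Data.Bool.≟ true) ×-dec (col c a b Fin.≟ κ)

module _ {n r} {G : Graph n} {c : EdgeColouring G r} (C : MonoCycle G c) where
  open MonoCycle C

  transport : ∀ {n′ r′} {G′ : Graph n′} {c′ : EdgeColouring G′ r′}
              (f : Fin n′ → Fin n) (vs : Fin (3 + m) → Fin n′) → (∀ j → f (vs j) ≡ verts j) → (κ : Fin r′) →
              (∀ i j → ColouredEdge G c colour (verts i) (verts j) → ColouredEdge G′ c′ κ (vs i) (vs j)) →
              MonoCycle G′ c′
  transport f vs f∘vs≗verts κ edge = record
    { m        = m
    ; verts    = vs
    ; distinct = λ e → distinct (trans (sym (f∘vs≗verts _)) (trans (cong f e) (f∘vs≗verts _)))
    ; colour   = κ
    ; stepAdj  = λ i → proj₁ (edge _ _ (stepAdj i , stepCol i))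
    ; stepCol  = λ i → proj₂ (edge _ _ (stepAdj i , stepCol i))
    ; closeAdj = proj₁ (edge _ _ (closeAdj , closeCol))
    ; closeCol = proj₂ (edge _ _ (closeAdj , closeCol))
    }

module _ {n} {G : Graph n} {P : Fin n → Set} (P? : ∀ w → Dec (P w)) where

  induced-cycle : ∀ {r} {c : EdgeColouring G r} {c′ : EdgeColouring (induced G P?) r} →
                  (∀ {a b} → P a → P b → adj G a b ≡ true → col c′ a b ≡ col c a b) →
                  (C : MonoCycle G c) → (∀ j → P (MonoCycle.verts C j)) → MonoCycle (induced G P?) c′
  induced-cycle same C inP = transport C id verts (λ _ → refl) colour λ i j (ij , κ) →
    induced-adj {G = G} P? (inP i) (inP j) ij , trans (same (inP i) (inP j) ij) κ
    where open MonoCycle C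

uniform : ∀ {n} (K : Graph n) → EdgeColouring K 1
uniform K = record { col = λ _ _ → zero ; colSym = λ _ _ → refl }

Cycle : ∀ {n} → Graph n → Set
Cycle K = MonoCycle K (uniform K)

Cycle-⊆ : ∀ {n} {H G : Graph n} → (∀ a b → adj H a b ≡ true → adj G a b ≡ true) → Cycle H → Cycle G
Cycle-⊆ H⊆G C = transport C id (MonoCycle.verts C) (λ _ → refl) zero λ i j (ij , _) → H⊆G _ _ ij , refl

anyFunction? : ∀ k {n} (P : (Fin k → Fin n) → Set) → (∀ {f g} → (∀ i → f i ≡ g i) → P f → P g) →
               (∀ f → Dec (P f)) → Dec (∃ P)
anyFunction? zero P resp P? with P? (λ ())
... | yes p = yes (_ , p)
... | no ¬p = no λ (f , pf) → ¬p (resp (λ ()) pf)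
anyFunction? (suc k) P resp P?
  with any? (λ x → anyFunction? k (P ∘ (x ∷_)) (λ f≗g → resp λ { zero → refl ; (suc i) → f≗g i }) (P? ∘ (x ∷_)))
... | yes (x , f , p) = yes (x ∷ f , p)
... | no ¬p = no λ (f , pf) → ¬p (f zero , f ∘ suc , resp (λ { zero → refl ; (suc i) → refl }) pf)

module _ {n r} (G : Graph n) (c : EdgeColouring G r) where

  IsMonoCycle : ∀ m → (Fin (3 + m) → Fin n) → Set
  IsMonoCycle m vs = (∀ i j → vs i ≡ vs j → i ≡ j) × ∃ λ κ →
    (∀ (i : Fin (2 + m)) → ColouredEdge G c κ (vs (inject₁ i)) (vs (suc i))) ×
    ColouredEdge G c κ (vs (fromℕ (2 + m))) (vs zero)

  isMonoCycle? : ∀ m vs → Dec (IsMonoCycle m vs)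
  isMonoCycle? m vs =
    all? (λ i → all? λ j → (vs i Fin.≟ vs j) →-dec (i Fin.≟ j)) ×-dec
    any? λ κ → all? (λ i → colouredEdge? G c κ _ _) ×-dec colouredEdge? G c κ _ _

  IsMonoCycle-resp : ∀ m {vs ws} → (∀ i → vs i ≡ ws i) → IsMonoCycle m vs → IsMonoCycle m ws
  IsMonoCycle-resp m {vs} {ws} vs≗ws (inj , κ , steps , close) =
    (λ i j e → inj i j (trans (vs≗ws i) (trans e (sym (vs≗ws j))))) , κ ,
    (λ i → moveEdge (steps i)) , moveEdge close
    where
    moveEdge : ∀ {κ i j} → ColouredEdge G c κ (vs i) (vs j) → ColouredEdge G c κ (ws i) (ws j)
    moveEdge = subst₂ (ColouredEdge G c _) (vs≗ws _) (vs≗ws _)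

  monoCycle? : Dec (MonoCycle G c)
  monoCycle? = map′ fromShape toShape
    (any? λ (l : Fin n) → anyFunction? (3 + toℕ l) (IsMonoCycle (toℕ l)) (IsMonoCycle-resp _) (isMonoCycle? _))
    where
    fromShape : (∃ λ l → ∃ (IsMonoCycle (toℕ l))) → MonoCycle G c
    fromShape (l , vs , inj , κ , steps , close) = record
      { m = toℕ l ; verts = vs ; distinct = inj _ _ ; colour = κ
      ; stepAdj = proj₁ ∘ steps ; stepCol = proj₂ ∘ steps ; closeAdj = proj₁ close ; closeCol = proj₂ close }
    toShape : MonoCycle G c → ∃ λ l → ∃ (IsMonoCycle (toℕ l))
    toShape C = fromℕ< m<n , subst (λ k → ∃ (IsMonoCycle k)) (sym (toℕ-fromℕ< m<n))
                  (verts , (λ _ _ → distinct) , colour , (λ i → stepAdj i , stepCol i) , closeAdj , closeCol)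
      where
      open MonoCycle C
      m<n : m < n
      m<n = ≤-trans (s≤s (m≤n+m m 2)) (injective⇒≤ distinct)

InR-⊎ : ∀ {r n₁ n₂} {H₁ : Graph n₁} {H₂ : Graph n₂} →
        (∀ c₁ c₂ → MonoCycle H₁ c₁ ⊎ MonoCycle H₂ c₂) → ¬ InR r H₁ → InR r H₂
InR-⊎ {H₂ = H₂} split ¬R₁ c₂ with monoCycle? H₂ c₂
... | yes C₂ = C₂
... | no ¬C₂ = ⊥-elim (¬R₁ λ c₁ → [ id , ⊥-elim ∘ ¬C₂ ] (split c₁ c₂))

InR⇒3≤n : ∀ {r n} {G : Graph n} → 0 < r → InR r G → 3 ≤ n
InR⇒3≤n {r} {G = G} 0<r R = ≤-trans (m≤m+n 3 _) (injective⇒≤ (MonoCycle.distinct (R constant)))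
  where
  constant : EdgeColouring G r
  constant = record { col = λ _ _ → fromℕ< 0<r ; colSym = λ _ _ → refl }

mod-injective : ∀ {a b r} .{{_ : NonZero r}} → a < r → b < r → a mod r ≡ b mod r → a ≡ b
mod-injective {a} {b} {r} a<r b<r e = begin
  a        ≡⟨ m<n⇒m%n≡m a<r ⟨
  a % r    ≡⟨ toℕ-fromℕ< (m%n<n a r) ⟨
  toℕ (a mod r) ≡⟨ cong toℕ e ⟩
  toℕ (b mod r) ≡⟨ toℕ-fromℕ< (m%n<n b r) ⟩
  b % r    ≡⟨ m<n⇒m%n≡m b<r ⟩
  b        ∎
  where open ≡-Reasoning

module CyclicWalk {n r} {G : Graph n} {c : EdgeColouring G r} (C : MonoCycle G c) where
  open MonoCycle C

  len : ℕ
  len = 3 + m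

  walk : ℕ → Fin n
  walk k = verts (k mod len)

  Edge : Fin n → Fin n → Set
  Edge = ColouredEdge G c colour

  walk-cong : ∀ a b → a % len ≡ b % len → walk a ≡ walk b
  walk-cong _ _ a≡b = cong verts (toℕ-injective (trans (toℕ-fromℕ< _) (trans a≡b (sym (toℕ-fromℕ< _)))))

  walk-verts : ∀ j → walk (toℕ j) ≡ verts j
  walk-verts j = cong verts (toℕ-injective (trans (toℕ-fromℕ< _) (m<n⇒m%n≡m (toℕ<n j))))

  walk-periodic : ∀ k → walk (k + len) ≡ walk k
  walk-periodic k = walk-cong (k + len) k ([m+n]%n≡m%n k len)

  walk-injective : ∀ {a b} → a < len → b < len → walk a ≡ walk b → a ≡ b
  walk-injective a<len b<len e = mod-injective a<len b<len (distinct e)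

  edge-after : ∀ j → Edge (verts j) (walk (suc (toℕ j)))
  edge-after j with toℕ j Data.Nat.≟ 2 + m
  ... | yes j≡last = subst₂ Edge (cong verts (toℕ-injective (trans (toℕ-fromℕ (2 + m)) (sym j≡last))))
                       (sym (begin
                         walk (suc (toℕ j)) ≡⟨ cong (walk ∘ suc) j≡last ⟩
                         walk len           ≡⟨ walk-periodic 0 ⟩
                         walk 0             ≡⟨ walk-verts zero ⟩
                         verts zero         ∎))
                       (closeAdj , closeCol)
    where open ≡-Reasoning
  ... | no j≢last = subst₂ Edge (cong verts (toℕ-injective (trans (toℕ-inject₁ i) (toℕ-lower₁ j _))))
                      (trans (sym (walk-verts (suc i))) (cong (walk ∘ suc) (toℕ-lower₁ j _)))
                      (stepAdj i , stepCol i)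
    where
    i : Fin (2 + m)
    i = Fin.lower₁ j (j≢last ∘ sym)

  walk-edge : ∀ k → Edge (walk k) (walk (suc k))
  walk-edge k = subst (Edge (walk k)) (walk-cong (suc (toℕ (k mod len))) (suc k) suc-%) (edge-after (k mod len))
    where
    suc-% : suc (toℕ (k mod len)) % len ≡ suc k % len
    suc-% = begin
      suc (toℕ (k mod len)) % len         ≡⟨ cong (λ z → suc z % len) (toℕ-fromℕ< (m%n<n k len)) ⟩
      suc (k % len) % len                 ≡⟨ [m+kn]%n≡m%n (suc (k % len)) (k / len) len ⟨
      suc (k % len + (k / len) * len) % len ≡⟨ cong (λ z → suc z % len) (m≡m%n+[m/n]*n k len) ⟨
      suc k % len                         ∎
      where open ≡-Reasoning

  walk-shift : ∀ a d → walk (d + a) ≡ walk (d + a % len)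
  walk-shift a d = walk-cong (d + a) (d + a % len) (begin
    (d + a) % len                   ≡⟨ %-distribˡ-+ d a len ⟩
    (d % len + a % len) % len       ≡⟨ cong (λ z → (d % len + z) % len) (m%n%n≡m%n a len) ⟨
    (d % len + a % len % len) % len ≡⟨ %-distribˡ-+ d (a % len) len ⟨
    (d + a % len) % len             ∎)
    where open ≡-Reasoning

  walk-window : ∀ a {d} → 0 < d → d < len → walk a ≢ walk (d + a)
  walk-window a {d} 0<d d<len e = within (d + ρ <? len)
    where
    ρ : ℕ
    ρ = a % len
    ρ<len : ρ < len
    ρ<len = m%n<n a len
    e′ : walk ρ ≡ walk (d + ρ)
    e′ = trans (walk-cong ρ a (m%n%n≡m%n a len)) (trans e (walk-shift a d))
    within : Dec (d + ρ < len) → ⊥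
    within (yes d+ρ<len) = <⇒≢ (m<n+m ρ 0<d) (walk-injective ρ<len d+ρ<len e′)
    within (no d+ρ≮len) = <⇒≢ wrapped<ρ (sym (walk-injective ρ<len wrapped<len (trans e′ (sym wrap))))
      where
      wrapped : ℕ
      wrapped = d + ρ ∸ len
      wrapped+len : wrapped + len ≡ d + ρ
      wrapped+len = m∸n+n≡m (≮⇒≥ d+ρ≮len)
      wrapped<ρ : wrapped < ρ
      wrapped<ρ = +-cancelʳ-< len wrapped ρ (subst (_< ρ + len) (sym wrapped+len)
                    (subst (d + ρ <_) (+-comm len ρ) (+-monoˡ-< ρ d<len)))
      wrapped<len : wrapped < len
      wrapped<len = <-trans wrapped<ρ ρ<len
      wrap : walk wrapped ≡ walk (d + ρ)
      wrap = trans (sym (walk-periodic wrapped)) (cong walk wrapped+len)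

  cycle-neighbours : ∀ t → ∃₂ λ p q → p ≢ q × Edge (verts t) p × Edge (verts t) q
  cycle-neighbours t =
    walk (toℕ t + (2 + m)) , walk (suc (toℕ t)) , p≢q ,
    ColouredEdge-sym {G = G} {c} (subst (Edge (walk (toℕ t + (2 + m)))) back (walk-edge (toℕ t + (2 + m)))) ,
    subst (λ v → Edge v (walk (suc (toℕ t)))) (walk-verts t) (walk-edge (toℕ t))
    where
    back : walk (suc (toℕ t + (2 + m))) ≡ verts t
    back = trans (cong walk (sym (+-suc (toℕ t) (2 + m)))) (trans (walk-periodic (toℕ t)) (walk-verts t))
    p≢q : walk (toℕ t + (2 + m)) ≢ walk (suc (toℕ t))
    p≢q e = walk-window (suc (toℕ t)) {1 + m} (s≤s z≤n) (n≤1+n (2 + m))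
              (sym (trans e′ e))
      where
      e′ : walk (1 + m + suc (toℕ t)) ≡ walk (toℕ t + (2 + m))
      e′ = cong walk (trans (+-suc (1 + m) (toℕ t)) (+-comm (2 + m) (toℕ t)))

  walk-avoiding : ∀ {x} k a → (∀ d → d < k → walk (suc d + a) ≢ x) →
                  ReachAvoid G x (walk a) (walk (k + a))
  walk-avoiding         zero    a avoid = here
  walk-avoiding {x = x} (suc k) a avoid =
    step (proj₁ (walk-edge a)) (avoid 0 z<s)
      (subst (ReachAvoid G x (walk (suc a)) ∘ walk) (+-suc k a)
        (walk-avoiding k (suc a) λ d d<k →
          subst (λ i → walk i ≢ x) (sym (+-suc (suc d) a)) (avoid (suc d) (s≤s d<k))))

  arc-length : ∀ {k s} t → k + suc t ≡ s → s < t + len → suc k < len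
  arc-length {k} {s} t k+t≡s s<t+len = +-cancelʳ-< t (suc k) len
    (subst (_< len + t) (trans (sym k+t≡s) (+-suc k t)) (subst (s <_) (+-comm t len) s<t+len))

  arc : ∀ {t j} → j ≢ t → ∃ λ k → suc k < len × walk (k + suc (toℕ t)) ≡ verts j
  arc {t} {j} j≢t with <-cmp (toℕ t) (toℕ j)
  ... | tri≈ _ t≡j _ = ⊥-elim (j≢t (toℕ-injective (sym t≡j)))
  ... | tri< t<j _ _ = toℕ j ∸ suc (toℕ t) ,
                       arc-length (toℕ t) (m∸n+n≡m t<j) (<-≤-trans (toℕ<n j) (m≤n+m len (toℕ t))) ,
                       trans (cong walk (m∸n+n≡m t<j)) (walk-verts j)
  ... | tri> _ _ j<t = toℕ j + len ∸ suc (toℕ t) ,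
                       arc-length (toℕ t) (m∸n+n≡m t<j+len) (+-monoˡ-< len j<t) ,
                       trans (cong walk (m∸n+n≡m t<j+len)) (trans (walk-periodic (toℕ j)) (walk-verts j))
    where
    t<j+len : suc (toℕ t) ≤ toℕ j + len
    t<j+len = ≤-trans (toℕ<n t) (m≤n+m len (toℕ j))

  -- Starting just after x, walking along the cycle meets every other vertex before x.
  connected-avoiding : ∀ x → ∃ λ b → b ≢ x × ∀ j → verts j ≢ x → ReachAvoid G x b (verts j)
  connected-avoiding x with any? (λ t → verts t Fin.≟ x)
  ... | no x∉C = walk 0 , x∉C ∘ (zero ,_) , λ j _ →
        subst (ReachAvoid G x (walk 0)) (trans (cong walk (+-identityʳ (toℕ j))) (walk-verts j))
          (walk-avoiding (toℕ j) 0 λ d _ → x∉C ∘ (_ ,_))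
  ... | yes (t , t≡x) = walk (suc (toℕ t)) , avoid 1 z<s (s≤s (s≤s z≤n)) , λ j j≢x →
        let k , k<len , k↦j = arc (λ j≡t → j≢x (trans (cong verts j≡t) t≡x)) in
        subst (ReachAvoid G x (walk (suc (toℕ t)))) k↦j
          (walk-avoiding k (suc (toℕ t)) λ d d<k →
            subst (λ i → walk i ≢ x) (sym (+-suc (suc d) (toℕ t))) (avoid (2 + d) z<s (≤-<-trans (s≤s d<k) k<len)))
    where
    avoid : ∀ d → 0 < d → d < len → walk (d + toℕ t) ≢ x
    avoid d 0<d d<len e = walk-window (toℕ t) 0<d d<len (trans (trans (walk-verts t) t≡x) (sym e))

-- Vertices of small degree

module _ {n} (G : Graph n) (v : Fin n) where

  neighbourBelow? : ∀ (b y : Fin n) → Dec (adj G v y ≡ true × toℕ y < toℕ b)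
  neighbourBelow? b y = (adj G v y Data.Bool.≟ true) ×-dec (toℕ y <? toℕ b)

  rank : Fin n → ℕ
  rank b = ∑[ y < n ] 𝟙 (does (neighbourBelow? b y))

  rank-<-mono : ∀ {b₁ b₂} → adj G v b₁ ≡ true → toℕ b₁ < toℕ b₂ → rank b₁ < rank b₂
  rank-<-mono {b₁} {b₂} vb₁ b₁<b₂ =
    ∑-mono-< (λ y → 𝟙-does-mono (neighbourBelow? b₁ y) (neighbourBelow? b₂ y)
                                λ (vy , y<b₁) → vy , <-trans y<b₁ b₁<b₂) b₁
             (𝟙-does-< (neighbourBelow? b₁ b₁) (neighbourBelow? b₂ b₁)
                       (λ (_ , b₁<b₁) → <-irrefl refl b₁<b₁) (vb₁ , b₁<b₂))

  rank<degree : ∀ {b} → adj G v b ≡ true → rank b < degree G v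
  rank<degree {b} vb = begin-strict
    rank b                           <⟨ ∑-mono-< (λ y → 𝟙-does-mono (neighbourBelow? b y) (atMost? y) below⇒atMost) b
                                          (𝟙-does-< (neighbourBelow? b b) (atMost? b) (λ (_ , b<b) → <-irrefl refl b<b)
                                                    (vb , ≤-refl)) ⟩
    ∑[ y < n ] 𝟙 (does (atMost? y))  ≤⟨ ∑-mono-≤ (λ y → 𝟙-mono (proj₁ ∘ from-does (atMost? y))) ⟩
    ∑[ y < n ] 𝟙 (adj G v y)         ≡⟨ degree≡∑ G v ⟨
    degree G v                       ∎
    where
    open ≤-Reasoning
    below⇒atMost : ∀ {y} → adj G v y ≡ true × toℕ y < toℕ b → adj G v y ≡ true × toℕ y ≤ toℕ b
    below⇒atMost (vy , y<b) = vy , <⇒≤ y<b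
    atMost? : ∀ (y : Fin n) → Dec (adj G v y ≡ true × toℕ y ≤ toℕ b)
    atMost? y = (adj G v y Data.Bool.≟ true) ×-dec (toℕ y ≤? toℕ b)

  rank-injective : ∀ {b₁ b₂} → adj G v b₁ ≡ true → adj G v b₂ ≡ true → rank b₁ ≡ rank b₂ → b₁ ≡ b₂
  rank-injective {b₁} {b₂} vb₁ vb₂ e with <-cmp (toℕ b₁) (toℕ b₂)
  ... | tri< b₁<b₂ _ _ = ⊥-elim (<⇒≢ (rank-<-mono vb₁ b₁<b₂) e)
  ... | tri≈ _ b₁≡b₂ _ = toℕ-injective b₁≡b₂
  ... | tri> _ _ b₂<b₁ = ⊥-elim (<⇒≢ (rank-<-mono vb₂ b₂<b₁) (sym e))

module _ {n r} .{{_ : NonZero r}} {G : Graph (suc n)} {v : Fin (suc n)}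
         (cH : EdgeColouring (deleteVertex G v) r) where

  -- On neighbours of v the rank is already below r once degree G v ≤ r; mod r only makes the
  -- colour total.
  extendedColour : ∀ a b → Dec (v ≡ a) → Dec (v ≡ b) → Fin r
  extendedColour a b (yes _)   _         = rank G v b mod r
  extendedColour a b (no _)    (yes _)   = rank G v a mod r
  extendedColour a b (no v≢a) (no v≢b) = col cH (punchOut v≢a) (punchOut v≢b)

  extendedColour-sym : ∀ a b va vb → extendedColour a b va vb ≡ extendedColour b a vb va
  extendedColour-sym a b (yes v≡a) (yes v≡b) = cong (λ w → rank G v w mod r) (trans (sym v≡b) v≡a)
  extendedColour-sym a b (yes _)   (no _)    = refl
  extendedColour-sym a b (no _)    (yes _)   = refl
  extendedColour-sym a b (no v≢a) (no v≢b) = colSym cH (punchOut v≢a) (punchOut v≢b)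

  extended : EdgeColouring G r
  extended = record
    { col    = λ a b → extendedColour a b (v Fin.≟ a) (v Fin.≟ b)
    ; colSym = λ a b → extendedColour-sym a b (v Fin.≟ a) (v Fin.≟ b)
    }

  extended-at : ∀ b → col extended v b ≡ rank G v b mod r
  extended-at b with v Fin.≟ v
  ... | yes _   = refl
  ... | no v≢v = ⊥-elim (v≢v refl)

  extended-punchIn : ∀ a b → col extended (punchIn v a) (punchIn v b) ≡ col cH a b
  extended-punchIn a b with v Fin.≟ punchIn v a | v Fin.≟ punchIn v b
  ... | yes v≡a | _       = ⊥-elim (punchInᵢ≢i v a (sym v≡a))
  ... | no _    | yes v≡b = ⊥-elim (punchInᵢ≢i v b (sym v≡b))
  ... | no _    | no _    = cong₂ (col cH) (trans (punchOut-cong v refl) (punchOut-punchIn v))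
                                          (trans (punchOut-cong v refl) (punchOut-punchIn v))

  module _ (small : degree G v ≤ r) where

    extended-injective-at : ∀ {κ p q} → ColouredEdge G extended κ v p → ColouredEdge G extended κ v q → p ≡ q
    extended-injective-at {κ} {p} {q} (vp , κp) (vq , κq) = rank-injective G v vp vq
      (mod-injective (<-≤-trans (rank<degree G v vp) small) (<-≤-trans (rank<degree G v vq) small) (begin
        rank G v p mod r ≡⟨ extended-at p ⟨
        col extended v p ≡⟨ κp ⟩
        κ                ≡⟨ κq ⟨
        col extended v q ≡⟨ extended-at q ⟩
        rank G v q mod r ∎))
      where open ≡-Reasoning

    extended-avoids : (C : MonoCycle G extended) → ∀ t → MonoCycle.verts C t ≢ v
    extended-avoids C t t≡v with CyclicWalk.cycle-neighbours C t
    ... | p , q , p≢q , tp , tq = p≢q (extended-injective-at (atV tp) (atV tq))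
      where
      atV : ∀ {w} → ColouredEdge G extended (MonoCycle.colour C) (MonoCycle.verts C t) w →
            ColouredEdge G extended (MonoCycle.colour C) v w
      atV {w} = subst (λ u → ColouredEdge G extended _ u w) t≡v

lowDegree⇒deleteVertex∈R : ∀ {n r} .{{_ : NonZero r}} {G : Graph (suc n)} {v} →
                           degree G v ≤ r → InR r G → InR r (deleteVertex G v)
lowDegree⇒deleteVertex∈R {G = G} {v} small R cH =
  transport C (punchIn v) (λ j → punchOut (avoids j ∘ sym)) (λ j → punchIn-punchOut _) colour λ i j e →
    let ij , κ = subst₂ (ColouredEdge G (extended cH) colour) (sym (punchIn-punchOut _)) (sym (punchIn-punchOut _)) e
    in ij , trans (sym (extended-punchIn {G = G} {v = v} cH _ _)) κ
  where
  C : MonoCycle G (extended cH)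
  C = R (extended cH)
  open MonoCycle C
  avoids : ∀ j → verts j ≢ v
  avoids = extended-avoids cH small C

minimal⇒r<degree : ∀ {r n} .{{_ : NonZero r}} {G : Graph n} → InM r G → ∀ v → r < degree G v
minimal⇒r<degree {r} {suc n} {G} minimal v with r <? degree G v
... | yes r<deg = r<deg
... | no r≮deg = ⊥-elim (minimal⇒¬InR-deleteVertex minimal v
                          (lowDegree⇒deleteVertex∈R (≮⇒≥ r≮deg) (proj₁ minimal)))

minimal⇒r<minDegree : ∀ {r n} .{{_ : NonZero r}} {G : Graph n} → InM r G → r < minDegree G
minimal⇒r<minDegree {r} {zero} minimal with InR⇒3≤n (>-nonZero⁻¹ r) (proj₁ minimal)
... | ()
minimal⇒r<minDegree {n = suc _} {G} minimal = ≤-minDegree G (minimal⇒r<degree minimal)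

-- Forests

module NonBacktracking {n} (K : Graph n)
                       (turn : ∀ {p c} → adj K p c ≡ true → ∃ λ q → adj K c q ≡ true × q ≢ p)
                       {p₀ c₀} (start : adj K p₀ c₀ ≡ true) where

  record Dart : Set where
    constructor dart
    field
      tail head : Fin n
      edge      : adj K tail head ≡ true

  advance : Dart → Dart
  advance (dart p c pc) = dart c (proj₁ (turn pc)) (proj₁ (proj₂ (turn pc)))

  dartAt : ℕ → Dart
  dartAt zero    = dart p₀ c₀ start
  dartAt (suc k) = advance (dartAt k)

  pos : ℕ → Fin n
  pos k = Dart.tail (dartAt k)

  pos-edge : ∀ k → adj K (pos k) (pos (suc k)) ≡ true
  pos-edge k = Dart.edge (dartAt k)

  pos-no-return : ∀ k → pos (suc (suc k)) ≢ pos k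
  pos-no-return k = proj₂ (proj₂ (turn (Dart.edge (dartAt k))))

  DistinctUpTo : ℕ → Set
  DistinctUpTo j = ∀ {a b} → a ≤ j → b ≤ j → pos a ≡ pos b → a ≡ b

  closeUp : ∀ i d → DistinctUpTo (i + d) → pos i ≡ pos (suc (i + d)) → Cycle K
  closeUp i zero dist back =
    ⊥-elim (adj⇒≢ K (pos-edge i) (trans back (cong (pos ∘ suc) (+-identityʳ i))))
  closeUp i (suc zero) dist back =
    ⊥-elim (pos-no-return i (sym (trans back (cong (pos ∘ suc) (+-comm i 1)))))
  closeUp i (suc (suc m)) dist back = record
    { m        = m
    ; verts    = vs
    ; distinct = λ e → toℕ-injective (+-cancelˡ-≡ i _ _ (dist (inRange _) (inRange _) e))
    ; colour   = zero
    ; stepAdj  = λ k → subst₂ (λ a b → adj K a b ≡ true)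
                          (cong (λ t → pos (i + t)) (sym (toℕ-inject₁ k))) (cong pos (sym (+-suc i (toℕ k))))
                          (pos-edge (i + toℕ k))
    ; stepCol  = λ _ → refl
    ; closeAdj = subst₂ (λ a b → adj K a b ≡ true)
                   (cong (λ t → pos (i + t)) (sym (toℕ-fromℕ (2 + m)))) (trans (sym back) (cong pos (sym (+-identityʳ i))))
                   (pos-edge (i + (2 + m)))
    ; closeCol = refl
    }
    where
    vs : Fin (3 + m) → Fin n
    vs k = pos (i + toℕ k)
    inRange : ∀ k → i + toℕ k ≤ i + (2 + m)
    inRange k = +-monoʳ-≤ i (≤-pred (toℕ<n k))

  extend : ∀ {j} → DistinctUpTo j → ¬ (∃ λ (i : Fin (suc j)) → pos (toℕ i) ≡ pos (suc j)) → DistinctUpTo (suc j)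
  extend {j} dist fresh {a} {b} a≤ b≤ e with m≤n⇒m<n∨m≡n a≤ | m≤n⇒m<n∨m≡n b≤
  ... | inj₁ a<  | inj₁ b<  = dist (≤-pred a<) (≤-pred b<) e
  ... | inj₂ a≡  | inj₂ b≡  = trans a≡ (sym b≡)
  ... | inj₁ a<  | inj₂ refl = ⊥-elim (fresh (fromℕ< a< , trans (cong pos (toℕ-fromℕ< a<)) e))
  ... | inj₂ refl | inj₁ b< = ⊥-elim (fresh (fromℕ< b< , trans (cong pos (toℕ-fromℕ< b<)) (sym e)))

  distinct-or-cycle : ∀ j → DistinctUpTo j ⊎ Cycle K
  distinct-or-cycle zero = inj₁ λ { z≤n z≤n _ → refl }
  distinct-or-cycle (suc j) with distinct-or-cycle j
  ... | inj₂ C = inj₂ C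
  ... | inj₁ dist with any? (λ (i : Fin (suc j)) → pos (toℕ i) Fin.≟ pos (suc j))
  ...   | no fresh = inj₁ (extend dist fresh)
  ...   | yes (i , repeat) = inj₂ (closeUp (toℕ i) (j ∸ toℕ i)
                                     (subst DistinctUpTo (sym i+d≡j) dist)
                                     (trans repeat (cong (pos ∘ suc) (sym i+d≡j))))
    where
    i+d≡j : toℕ i + (j ∸ toℕ i) ≡ j
    i+d≡j = m+[n∸m]≡n (≤-pred (toℕ<n i))

  cycle : Cycle K
  cycle with distinct-or-cycle n
  ... | inj₂ C    = C
  ... | inj₁ dist = ⊥-elim (1+n≰n (injective⇒≤ {f = λ (i : Fin (suc n)) → pos (toℕ i)}
                              λ e → toℕ-injective (dist (≤-pred (toℕ<n _)) (≤-pred (toℕ<n _)) e)))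

leaf-removal-bounds : ∀ {N N′ D D′} → N′ < N → 2 ≤ N → 2 * N ≤ D + 1 → D ≤ D′ + 2 →
                      1 ≤ D′ × 2 * N′ ≤ D′ + 1
leaf-removal-bounds {N} {N′} {D} {D′} N′<N 2≤N dense D≤ =
  +-cancelʳ-≤ 3 1 D′ (begin
    4            ≤⟨ *-monoʳ-≤ 2 2≤N ⟩
    2 * N        ≤⟨ dense ⟩
    D + 1        ≤⟨ +-monoˡ-≤ 1 D≤ ⟩
    D′ + 2 + 1   ≡⟨ +-assoc D′ 2 1 ⟩
    D′ + 3       ∎) ,
  +-cancelʳ-≤ 2 (2 * N′) (D′ + 1) (begin
    2 * N′ + 2   ≡⟨ +-comm (2 * N′) 2 ⟩
    2 + 2 * N′   ≡⟨ *-suc 2 N′ ⟨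
    2 * suc N′   ≤⟨ *-monoʳ-≤ 2 N′<N ⟩
    2 * N        ≤⟨ dense ⟩
    D + 1        ≤⟨ +-monoˡ-≤ 1 D≤ ⟩
    D′ + 2 + 1   ≡⟨ +-assoc D′ 2 1 ⟩
    D′ + 3       ≡⟨ +-assoc D′ 1 2 ⟨
    D′ + 1 + 2   ∎)
  where open ≤-Reasoning

leafless⇒Cycle : ∀ {n} (K : Graph n) → 1 ≤ degreeSum K → (∀ w → degree K w ≢ 1) → Cycle K
leafless⇒Cycle {n} K 1≤D leafless = NonBacktracking.cycle K turn (proj₂ (neighbour K w₀ 1≤deg))
  where
  w₀ : Fin n
  w₀ = proj₁ (∑-pos (degree K) 1≤D)
  1≤deg : 1 ≤ degree K w₀
  1≤deg = proj₂ (∑-pos (degree K) 1≤D)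
  turn : ∀ {p c} → adj K p c ≡ true → ∃ λ q → adj K c q ≡ true × q ≢ p
  turn {p} {c} pc with any? (λ q → (adj K c q Data.Bool.≟ true) ×-dec ¬? (q Fin.≟ p))
  ... | yes found = found
  ... | no none = ⊥-elim (leafless c (≤-antisym deg≤1 (adj⇒1≤degree K (trans (Graph.sym K c p) pc))))
    where
    deg≤1 : degree K c ≤ 1
    deg≤1 = begin
      degree K c                         ≡⟨ degree≡∑ K c ⟩
      ∑[ q < n ] 𝟙 (adj K c q)           ≤⟨ ∑-mono-≤ (λ q → 𝟙-mono λ cq →
                                              dec-true (q Fin.≟ p) (decidable-stable (q Fin.≟ p) λ q≢p → none (q , cq , q≢p))) ⟩
      ∑[ q < n ] 𝟙 (does (q Fin.≟ p))    ≡⟨ ∑-𝟙-≟ p ⟩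
      1                                  ∎
      where open ≤-Reasoning

-- The bound says that K has at least as many edges as non-isolated vertices. Deleting the
-- edge at a leaf preserves it; without leaves a non-backtracking walk closes a cycle.
hasCycle : ∀ {n} (K : Graph n) → Acc _<_ (degreeSum K) →
           1 ≤ degreeSum K → 2 * nonIsolated K ≤ degreeSum K + 1 → Cycle K
hasCycle {n} K (acc smaller) 1≤D dense with any? (λ w → degree K w Data.Nat.≟ 1)
... | no leafless = leafless⇒Cycle K 1≤D λ w leaf → leafless (w , leaf)
... | yes (w , leaf) with neighbour K w (≤-reflexive (sym leaf))
...   | y , wy = Cycle-⊆ (deleteEdge⊆ K w y) (hasCycle K′ (smaller D′<D) (proj₁ bounds) (proj₂ bounds))
  where
  K′ : Graph n
  K′ = deleteEdge K w y
  w-loses : degree K′ w < degree K w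
  w-loses = degree-⊂ {G = K} {H = K′} (deleteEdge⊆ K w y) wy (deleteEdge-deleted K w y)
  loses : ∀ u → degree K′ u ≤ degree K u
  loses = degree-⊆ {G = K} {H = K′} (deleteEdge⊆ K w y)
  D′<D : degreeSum K′ < degreeSum K
  D′<D = ∑-mono-< loses w w-loses
  N′<N : nonIsolated K′ < nonIsolated K
  N′<N = ∑-mono-< (λ u → 𝟙-does-mono (1 ≤? _) (1 ≤? _) λ 1≤ → ≤-trans 1≤ (loses u)) w
           (𝟙-does-< (1 ≤? _) (1 ≤? _) (λ 1≤ → ≤⇒≯ 1≤ (subst (degree K′ w <_) leaf w-loses)) (≤-reflexive (sym leaf)))
  2≤N : 2 ≤ nonIsolated K
  2≤N = ∑-two _ (adj⇒≢ K wy) (nonIsolated-at K wy) (nonIsolated-at K (trans (Graph.sym K y w) wy))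
  bounds : 1 ≤ degreeSum K′ × 2 * nonIsolated K′ ≤ degreeSum K′ + 1
  bounds = leaf-removal-bounds N′<N 2≤N dense (degreeSum-deleteEdge K w y)

module _ {n r} (H : Graph n) (c : EdgeColouring H r) where

  colourClass-cycle : ∀ κ → Cycle (colourClass H c κ) → MonoCycle H c
  colourClass-cycle κ C = transport C id (MonoCycle.verts C) (λ _ → refl) κ λ i j (ij , _) →
    ∧-conicalˡ _ _ ij , sym (from-does (κ Fin.≟ _) (∧-conicalʳ _ _ ij))

  degree-colourClasses : ∀ u → ∑[ κ < r ] degree (colourClass H c κ) u ≡ degree H u
  degree-colourClasses u = begin
    ∑[ κ < r ] degree (colourClass H c κ) u                      ≡⟨ sum-cong-≗ (λ κ → degree≡∑ (colourClass H c κ) u) ⟩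
    ∑[ κ < r ] ∑[ b < n ] 𝟙 (adj H u b ∧ does (κ Fin.≟ col c u b)) ≡⟨ ∑-comm (λ κ b → 𝟙 (adj H u b ∧ does (κ Fin.≟ col c u b))) ⟩
    ∑[ b < n ] ∑[ κ < r ] 𝟙 (adj H u b ∧ does (κ Fin.≟ col c u b)) ≡⟨ sum-cong-≗ (λ b → ∑-𝟙-∧-≟ (adj H u b) (col c u b)) ⟩
    ∑[ b < n ] 𝟙 (adj H u b)                                     ≡⟨ degree≡∑ H u ⟨
    degree H u                                                   ∎
    where open ≡-Reasoning

  degreeSum-colourClasses : ∑[ κ < r ] degreeSum (colourClass H c κ) ≡ degreeSum H
  degreeSum-colourClasses = trans (∑-comm (λ κ u → degree (colourClass H c κ) u)) (sum-cong-≗ degree-colourClasses)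

-- A colouring without monochromatic cycles splits H into r forests, each with fewer than n
-- edges.
dense⇒InR : ∀ {r n} (H : Graph n) → 1 ≤ n → n * (2 * r) + 2 ≤ degreeSum H + 2 * r → InR r H
dense⇒InR {r} {n} H 1≤n dense c with any? (λ κ → 2 * n ≤? degreeSum (colourClass H c κ) + 1)
... | yes (κ , rich) = colourClass-cycle H c κ
  (hasCycle (colourClass H c κ) (<-wellFounded _) (+-cancelʳ-≤ 1 1 _ (≤-trans (*-monoʳ-≤ 2 1≤n) rich))
            (≤-trans (*-monoʳ-≤ 2 (nonIsolated≤n (colourClass H c κ))) rich))
... | no poor = ⊥-elim (m+1+n≰m (n * (2 * r)) (≤-trans dense (begin
    degreeSum H + 2 * r                                  ≡⟨ cong₂ _+_ (degreeSum-colourClasses H c) (*-comm r 2) ⟨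
    ∑[ κ < r ] degreeSum (K κ) + r * 2                   ≡⟨ cong (∑[ κ < r ] degreeSum (K κ) +_) (∑-const r 2) ⟨
    ∑[ κ < r ] degreeSum (K κ) + ∑[ κ < r ] 2            ≡⟨ ∑-distrib-+ (λ κ → degreeSum (K κ)) (λ _ → 2) ⟨
    ∑[ κ < r ] (degreeSum (K κ) + 2)                     ≤⟨ ∑-≤-* (λ κ → degreeSum (K κ) + 2) each ⟩
    r * (2 * n)                                          ≡⟨ *-assoc r 2 n ⟨
    r * 2 * n                                            ≡⟨ cong (_* n) (*-comm r 2) ⟩
    2 * r * n                                            ≡⟨ *-comm (2 * r) n ⟩
    n * (2 * r)                                          ∎)))
  where
  open ≤-Reasoning
  K : Fin r → Graph n
  K = colourClass H c
  each : ∀ κ → degreeSum (K κ) + 2 ≤ 2 * n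
  each κ = subst (_≤ 2 * n) (sym (+-suc (degreeSum (K κ)) 1)) (≰⇒> (λ rich → poor (κ , rich)))

minimal⇒minDegree<2r : ∀ {r n} {G : Graph n} → 2 ≤ r → InM r G → minDegree G < 2 * r
minimal⇒minDegree<2r {r} {zero}          2≤r minimal = ≤-trans (s≤s z≤n) (*-monoʳ-≤ 2 2≤r)
minimal⇒minDegree<2r {r} {suc n} {G} 2≤r minimal with minDegree G <? 2 * r
... | yes δ<2r = δ<2r
... | no δ≮2r  = ⊥-elim (minimal⇒¬InR-spanning minimal G′ (deleteEdge⊆ G zero y) zy (deleteEdge-deleted G zero y)
                          (dense⇒InR G′ (s≤s z≤n) (begin
                            suc n * (2 * r) + 2    ≤⟨ +-monoˡ-≤ 2 (*-≤-∑ (degree G) highDegree) ⟩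
                            degreeSum G + 2        ≤⟨ +-monoˡ-≤ 2 (degreeSum-deleteEdge G zero y) ⟩
                            degreeSum G′ + 2 + 2   ≡⟨ +-assoc (degreeSum G′) 2 2 ⟩
                            degreeSum G′ + 4       ≤⟨ +-monoʳ-≤ (degreeSum G′) (*-monoʳ-≤ 2 2≤r) ⟩
                            degreeSum G′ + 2 * r   ∎)))
  where
  open ≤-Reasoning
  highDegree : ∀ v → 2 * r ≤ degree G v
  highDegree v = ≤-trans (≮⇒≥ δ≮2r) (minDegree≤degree G v)
  edge : ∃ λ y → adj G zero y ≡ true
  edge = neighbour G zero (≤-trans (≤-trans (s≤s z≤n) (*-monoʳ-≤ 2 2≤r)) (highDegree zero))
  y : Fin (suc n)
  y = proj₁ edge
  zy : adj G zero y ≡ true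
  zy = proj₂ edge
  G′ : Graph (suc n)
  G′ = deleteEdge G zero y

-- Cut vertices

module Separation {n} (G : Graph n) (x u : Fin n) (u≢x : u ≢ x) where

  -- Inner is the component of u in G − x together with x; Outer, its complement, also contains x.
  Inner Outer : Fin n → Set
  Inner w = ReachAvoid G x u w ⊎ w ≡ x
  Outer w = ¬ ReachAvoid G x u w

  inner? : ∀ w → Dec (Inner w)
  inner? w = reachAvoid? G x u w ⊎-dec (w Fin.≟ x)

  outer? : ∀ w → Dec (Outer w)
  outer? w = ¬? (reachAvoid? G x u w)

  inner∩outer⇒x : ∀ {w} → Inner w → Outer w → w ≡ x
  inner∩outer⇒x (inj₁ uw) ¬uw = ⊥-elim (¬uw uw)
  inner∩outer⇒x (inj₂ w≡x) _  = w≡x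

  module _ {r} (cA : EdgeColouring (induced G inner?) r) (cB : EdgeColouring (induced G outer?) r) where

    joinedColour : Fin n → Fin n → Fin r
    joinedColour a b = if does (inner? a) ∧ does (inner? b) then col cA a b else col cB a b

    joinedColour-sym : ∀ a b → joinedColour a b ≡ joinedColour b a
    joinedColour-sym a b rewrite ∧-comm (does (inner? a)) (does (inner? b)) | colSym cA a b | colSym cB a b = refl

    joined : EdgeColouring G r
    joined = record { col = joinedColour ; colSym = joinedColour-sym }

    joined-inner : ∀ {a b} → Inner a → Inner b → adj G a b ≡ true → col cA a b ≡ col joined a b
    joined-inner {a} {b} ia ib _ rewrite dec-true (inner? a) ia | dec-true (inner? b) ib = refl

    joined-outer : ∀ {a b} → Outer a → Outer b → adj G a b ≡ true → col cB a b ≡ col joined a b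
    joined-outer {a} {b} oa ob ab
      rewrite dec-false (inner? a ×-dec inner? b)
                (λ (ia , ib) → adj⇒≢ G ab (trans (inner∩outer⇒x ia oa) (sym (inner∩outer⇒x ib ob)))) = refl

    split : MonoCycle G joined → MonoCycle (induced G inner?) cA ⊎ MonoCycle (induced G outer?) cB
    split C with CyclicWalk.connected-avoiding C x
    ... | b , b≢x , path with reachAvoid? G x u b
    ...   | yes ub = inj₁ (induced-cycle inner? joined-inner C inside)
      where
      inside : ∀ j → Inner (MonoCycle.verts C j)
      inside j with MonoCycle.verts C j Fin.≟ x
      ... | yes j≡x = inj₂ j≡x
      ... | no j≢x  = inj₁ (ReachAvoid-++ ub (path j j≢x))
    ...   | no ¬ub = inj₂ (induced-cycle outer? joined-outer C outside)
      where
      outside : ∀ j → Outer (MonoCycle.verts C j)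
      outside j with MonoCycle.verts C j Fin.≟ x
      ... | yes j≡x = λ uj → ¬ReachAvoid-avoided u≢x (subst (ReachAvoid G x u) j≡x uj)
      ... | no j≢x  = λ uj → ¬ub (ReachAvoid-++ uj (ReachAvoid-reverse b≢x (path j j≢x)))

minimal⇒ReachAvoid : ∀ {r n} {G : Graph n} → InM r G → (∀ w → ∃ λ z → adj G w z ≡ true) →
                     ∀ {x u v} → u ≢ x → v ≢ x → ReachAvoid G x u v
minimal⇒ReachAvoid {G = G} minimal hasNeighbour {x} {u} {v} u≢x v≢x with reachAvoid? G x u v
... | yes uv = uv
... | no ¬uv = ⊥-elim (minimal⇒¬InR-induced minimal outer? (λ ¬uu → ¬uu here) (proj₂ (hasNeighbour u))
                 (InR-⊎ (λ cA cB → split cA cB (proj₁ minimal (joined cA cB)))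
                        (minimal⇒¬InR-induced minimal inner? [ ¬uv , v≢x ] (proj₂ (hasNeighbour v)))))
  where open Separation G x u u≢x

thirdVertex : ∀ {k} {u v : Fin (3 + k)} → u ≢ v → ∃ λ x → u ≢ x × v ≢ x
thirdVertex {k} {u} {v} u≢v = punchIn u (punchIn v′ zero) , punchInᵢ≢i u _ ∘ sym , v≢x
  where
  v′ : Fin (2 + k)
  v′ = punchOut u≢v
  v≢x : v ≢ punchIn u (punchIn v′ zero)
  v≢x v≡x = punchInᵢ≢i v′ zero (sym (punchIn-injective u _ _ (trans (punchIn-punchOut u≢v) v≡x)))

avoiding⇒Connected : ∀ {n} {G : Graph n} → 3 ≤ n → (∀ {x u v} → u ≢ x → v ≢ x → ReachAvoid G x u v) → Connected G
avoiding⇒Connected (s≤s (s≤s (s≤s _))) avoiding u v with u Fin.≟ v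
... | yes refl = here
... | no u≢v   = let x , u≢x , v≢x = thirdVertex u≢v in ReachAvoid⇒Reach (avoiding u≢x v≢x)

minimal⇒TwoConnected : ∀ {r n} .{{_ : NonZero r}} {G : Graph n} → InM r G → TwoConnected G
minimal⇒TwoConnected {r} {n} {G} minimal = 3≤n , avoiding⇒Connected 3≤n avoiding , λ _ _ _ → avoiding
  where
  3≤n : 3 ≤ n
  3≤n = InR⇒3≤n (>-nonZero⁻¹ r) (proj₁ minimal)
  avoiding : ∀ {x u v} → u ≢ x → v ≢ x → ReachAvoid G x u v
  avoiding = minimal⇒ReachAvoid minimal λ w → neighbour G w (≤-trans (s≤s z≤n) (minimal⇒r<degree minimal w))

lemma2p1 : (r : ℕ) → 2 ≤ r → (n : ℕ) (G : Graph n) → InM r G →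
    (r + 1 ≤ minDegree G) × (minDegree G ≤ 2 * r ∸ 1) × TwoConnected G
lemma2p1 r@(suc _) 2≤r n G minimal =
  subst (_≤ minDegree G) (+-comm 1 r) (minimal⇒r<minDegree minimal) ,
  <⇒≤pred (minimal⇒minDegree<2r 2≤r minimal) ,
  minimal⇒TwoConnected minimal
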